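{- Let $\mathcal{C}$ be a graph class and $k\ge 0$ an integer. If $\mathcal{C}$ has a distance-vector labelling scheme with labels of at most $k$ bits, then $\mathcal{C}$ has an isometric-universal graph with at most $2^{k+1}-1$ vertices.
   Context: $d_G(u,v)$ is the distance in $G$ (possibly $\infty$). A subgraph $G$ of $H$ is isometric if $d_G(u,v)=d_H(u,v)$ for all $u,v\in V(G)$; $H$ is isometric-universal for $\mathcal{C}$ if it contains an isometric copy of every $G\in\mathcal{C}$. A distance-vector labelling scheme for $\mathcal{C}$ with labels of at most $k$ bits is a function $D:\{0,1\}^*\to(\mathbb{N}\cup\{\infty\})^*$ (from finite binary strings to finite sequences over $\mathbb{N}\cup\{\infty\}$) such that for every $G\in\mathcal{C}$ there exist an ordering $v_1,\dots,v_n$ of $V(G)$ and a function $\ell_G:V(G)\to\{0,1\}^*$ with $|\ell_G(v)|\le k$ for all $v$, such that $D(\ell_G(v))=(d_G(v,v_1),\dots,d_G(v,v_n))$ for every $v\in V(G)$. -}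

module Defs where

open import Data.Nat using (ℕ; zero; suc; _≤_; _∸_; _^_)
open import Data.Bool using (Bool; true; false)
open import Data.Fin using (Fin)
open import Data.List using (List; length)
open import Data.Vec using (Vec; lookup; toList)
open import Data.Product using (Σ; ∃; _×_; _,_)
open import Relation.Binary.PropositionalEquality using (_≡_)
open import Relation.Nullary using (¬_)
open import Function.Base using (_∘_)
open import Function.Definitions using (Injective)
open import Function.Bundles using (_⤖_; module Bijection)

data ℕ∞ : Set where
  fin : ℕ → ℕ∞
  ∞   : ℕ∞

record Graph : Set where
  field
    n       : ℕ
    adj     : Fin n → Fin n → Bool
    adj-sym : ∀ u v → adj u v ≡ adj v u
    adj-irr : ∀ u → adj u u ≡ false
open Graph public

V : Graph → Set
V G = Fin (n G)

Edge : (G : Graph) → V G → V G → Set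
Edge G u v = adj G u v ≡ true

data Walk (G : Graph) : V G → V G → ℕ → Set where
  nil  : ∀ {u} → Walk G u u 0
  cons : ∀ {u w v m} → Edge G u w → Walk G w v m → Walk G u v (suc m)

IsDist : (G : Graph) → V G → V G → ℕ∞ → Set
IsDist G u v (fin m) = Walk G u v m × (∀ m' → Walk G u v m' → m ≤ m')
IsDist G u v ∞       = ∀ m → ¬ Walk G u v m

IsometricCopy : Graph → Graph → Set
IsometricCopy G H =
  Σ (V G → V H) λ f →
    Injective _≡_ _≡_ f
    × (∀ u v → Edge G u v → Edge H (f u) (f v))
    × (∀ u v d → (IsDist G u v d → IsDist H (f u) (f v) d)
                × (IsDist H (f u) (f v) d → IsDist G u v d))

IsometricUniversal : (Graph → Set) → Graph → Set
IsometricUniversal C H = ∀ G → C G → IsometricCopy G H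

DistanceVectorScheme : (Graph → Set) → ℕ → (List Bool → List ℕ∞) → Set
DistanceVectorScheme C k D =
  ∀ G → C G →
    Σ (Fin (n G) ⤖ V G) λ ord →
    Σ (V G → List Bool) λ ℓ →
      (∀ v → length (ℓ v) ≤ k)
      × (∀ v → Σ (Vec ℕ∞ (n G)) λ ds →
             D (ℓ v) ≡ toList ds
             × (∀ i → IsDist G v (Bijection.to ord i) (lookup ds i)))

-- The universal graph H has one vertex for every label of at most k bits, two labels being
-- adjacent when their decoded vectors are distinct and differ by at most one in every
-- coordinate. A graph G of the class embeds by sending v to its label: an edge of G changes
-- every distance d(·, v_i) by at most one, so edges are preserved and d_H ≤ d_G. Conversely,
-- along a walk of length m in H every coordinate changes by at most m, and the vector of v_i
-- has 0 in coordinate i, so a walk from the label of u to that of v_i has length at least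
-- d_G(u, v_i).
module Submission where

open import Defs
open import Data.Nat using (ℕ; zero; suc; _+_; _≤_; _∸_; _^_; _≤?_; z≤n; s≤s)
open import Data.Nat.Properties
  using (≤-antisym; ≤-trans; ≤-reflexive; +-monoʳ-≤; +-assoc; +-comm; +-suc; +-identityʳ)
open import Data.Bool using (Bool; true; false)
open import Data.List using (List; []; _∷_; [_]; length; map; _++_; lookup)
open import Data.List.Properties using (length-map; length-++)
open import Data.List.Membership.Propositional using (_∈_)
open import Data.List.Membership.Propositional.Properties using (∈-map⁺; ∈-++⁺ˡ; ∈-++⁺ʳ)
open import Data.List.Relation.Unary.Any using (here; there; index)
open import Data.List.Relation.Unary.Any.Properties using (lookup-index)
open import Data.List.Relation.Binary.Pointwise
  using (Pointwise; []; _∷_; decidable; symmetric; transitive; ≡⇒Pointwise-≡)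
  renaming (refl to Pointwise-refl)
open import Data.Vec using (Vec; toList) renaming (_∷_ to _∷ᵥ_; [] to []ᵥ; lookup to lookupᵥ)
open import Data.Fin using (Fin) renaming (zero to fzero; suc to fsuc; _≟_ to _≟ᶠ_)
open import Data.Product using (Σ; ∃; _×_; _,_; proj₁; proj₂; swap)
open import Data.Empty using (⊥-elim)
open import Function.Base using (_∘_)
open import Function.Bundles using (mk⇔; module Bijection)
open import Function.Definitions using (Injective)
open import Level using (0ℓ)
open import Relation.Binary.Core using (Rel)
open import Relation.Binary.Definitions using (Decidable; Symmetric)
open import Relation.Binary.PropositionalEquality
  using (_≡_; _≢_; refl; sym; trans; cong; cong₂; subst; subst₂; module ≡-Reasoning)
open import Relation.Nullary using (¬_; Dec; yes; no; does; ¬?; _×-dec_)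
open import Relation.Nullary.Decidable using (map′; dec-true; dec-false; does-⇔)

infix 4 _≲[_]_

data _≲[_]_ : ℕ∞ → ℕ → ℕ∞ → Set where
  fin≲fin : ∀ {a b m} → a ≤ m + b → fin a ≲[ m ] fin b
  _≲∞ : ∀ x {m} → x ≲[ m ] ∞

≲-refl : ∀ x → x ≲[ 0 ] x
≲-refl (fin a) = fin≲fin (≤-reflexive refl)
≲-refl ∞ = ∞ ≲∞

≲-trans : ∀ {x y z m n} → x ≲[ m ] y → y ≲[ n ] z → x ≲[ m + n ] z
≲-trans {m = m} {n} (fin≲fin {b = b} a≤m+b) (fin≲fin {b = c} b≤n+c) =
  fin≲fin (≤-trans a≤m+b (≤-trans (+-monoʳ-≤ m b≤n+c) (≤-reflexive (sym (+-assoc m n c)))))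
≲-trans {x = x} _ (_ ≲∞) = x ≲∞

≲-fin-zero : ∀ {a m} → fin a ≲[ m ] fin 0 → a ≤ m
≲-fin-zero {m = m} (fin≲fin a≤m+0) = ≤-trans a≤m+0 (≤-reflexive (+-identityʳ m))

∞-≴-fin : ∀ {m b} → ¬ (∞ ≲[ m ] fin b)
∞-≴-fin ()

_≲?[_]_ : ∀ x m y → Dec (x ≲[ m ] y)
fin a ≲?[ m ] fin b = map′ fin≲fin (λ { (fin≲fin p) → p }) (a ≤? m + b)
x ≲?[ m ] ∞ = yes (x ≲∞)
∞ ≲?[ m ] fin b = no ∞-≴-fin

Close : Rel ℕ∞ 0ℓ
Close x y = x ≲[ 1 ] y × y ≲[ 1 ] x

close? : Decidable Close
close? x y = (x ≲?[ 1 ] y) ×-dec (y ≲?[ 1 ] x)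

Pointwise-toList⁺ : ∀ {A B : Set} {R : A → B → Set} {m} {xs : Vec A m} {ys : Vec B m} →
  (∀ i → R (lookupᵥ xs i) (lookupᵥ ys i)) → Pointwise R (toList xs) (toList ys)
Pointwise-toList⁺ {xs = []ᵥ} {[]ᵥ} _ = []
Pointwise-toList⁺ {xs = _ ∷ᵥ _} {_ ∷ᵥ _} R-lookup =
  R-lookup fzero ∷ Pointwise-toList⁺ (R-lookup ∘ fsuc)

Pointwise-toList⁻ : ∀ {A B : Set} {R : A → B → Set} {m} {xs : Vec A m} {ys : Vec B m} →
  Pointwise R (toList xs) (toList ys) → ∀ i → R (lookupᵥ xs i) (lookupᵥ ys i)
Pointwise-toList⁻ {xs = _ ∷ᵥ _} {_ ∷ᵥ _} (r ∷ _) fzero = r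
Pointwise-toList⁻ {xs = _ ∷ᵥ _} {_ ∷ᵥ _} (_ ∷ rs) (fsuc i) = Pointwise-toList⁻ rs i

module _ (G : Graph) where

  Edge-sym : ∀ {u v} → Edge G u v → Edge G v u
  Edge-sym {u} {v} e = trans (adj-sym G v u) e

  Edge-irrefl : ∀ {u} → ¬ Edge G u u
  Edge-irrefl {u} e with trans (sym e) (adj-irr G u)
  ... | ()

  IsDist-refl : ∀ u → IsDist G u u (fin 0)
  IsDist-refl u = nil , λ _ _ → z≤n

  IsDist-zero : ∀ {u v} → IsDist G u v (fin 0) → u ≡ v
  IsDist-zero (nil , _) = refl

  IsDist-unique : ∀ {u v} d d′ → IsDist G u v d → IsDist G u v d′ → d ≡ d′
  IsDist-unique (fin a) (fin b) (wa , min-a) (wb , min-b) = cong fin (≤-antisym (min-a b wb) (min-b a wa))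
  IsDist-unique (fin a) ∞ (wa , _) none = ⊥-elim (none a wa)
  IsDist-unique ∞ (fin b) none (wb , _) = ⊥-elim (none b wb)
  IsDist-unique ∞ ∞ _ _ = refl

  IsDist-edge : ∀ {u v w x y} → Edge G u v → IsDist G u w x → IsDist G v w y → x ≲[ 1 ] y
  IsDist-edge {x = fin a} {fin b} e (_ , min-a) (wb , _) = fin≲fin (min-a (suc b) (cons e wb))
  IsDist-edge {x = x} {∞} e _ _ = x ≲∞
  IsDist-edge {x = ∞} {fin b} e none (wb , _) = ⊥-elim (none (suc b) (cons e wb))

  IsDist-close : ∀ {u v w x y} → Edge G u v → IsDist G u w x → IsDist G v w y → Close x y
  IsDist-close e dx dy = IsDist-edge e dx dy , IsDist-edge (Edge-sym e) dy dx

module _ {G H : Graph} (f : V G → V H) (f-edge : ∀ u v → Edge G u v → Edge H (f u) (f v)) where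

  Walk-map : ∀ {u v m} → Walk G u v m → Walk H (f u) (f v) m
  Walk-map nil = nil
  Walk-map (cons e w) = cons (f-edge _ _ e) (Walk-map w)

  isometricCopy : Injective _≡_ _≡_ f →
    (∀ u v → ∃ λ d → IsDist G u v d × IsDist H (f u) (f v) d) → IsometricCopy G H
  isometricCopy f-inj dist = f , f-inj , f-edge , preserves
    where
    preserves : ∀ u v d → (IsDist G u v d → IsDist H (f u) (f v) d)
                        × (IsDist H (f u) (f v) d → IsDist G u v d)
    preserves u v d with dist u v
    ... | _ , dG , dH =
      (λ dG′ → subst (IsDist H (f u) (f v)) (IsDist-unique G _ _ dG dG′) dH) ,
      (λ dH′ → subst (IsDist G u v) (IsDist-unique H _ _ dH dH′) dG)

module _ {N : ℕ} {R : Rel (Fin N) 0ℓ} (R? : Decidable R) (R-sym : Symmetric R) (R-irr : ∀ a → ¬ R a a) where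

  relationGraph : Graph
  relationGraph = record
    { n       = N
    ; adj     = λ a b → does (R? a b)
    ; adj-sym = λ a b → does-⇔ (mk⇔ R-sym R-sym) (R? a b) (R? b a)
    ; adj-irr = λ a → dec-false (R? a a) (R-irr a)
    }

  Edge⇒rel : ∀ {a b} → Edge relationGraph a b → R a b
  Edge⇒rel {a} {b} e with R? a b
  ... | yes r = r

  rel⇒Edge : ∀ {a b} → R a b → Edge relationGraph a b
  rel⇒Edge {a} {b} = dec-true (R? a b)

module _ {N : ℕ} (L : Fin N → List ℕ∞) where

  AdjacentVectors : Rel (Fin N) 0ℓ
  AdjacentVectors a b = a ≢ b × Pointwise Close (L a) (L b)

  adjacentVectors? : Decidable AdjacentVectors
  adjacentVectors? a b = ¬? (a ≟ᶠ b) ×-dec decidable close? (L a) (L b)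

  AdjacentVectors-sym : Symmetric AdjacentVectors
  AdjacentVectors-sym (a≢b , close) = a≢b ∘ sym , symmetric swap close

  AdjacentVectors-irr : ∀ a → ¬ AdjacentVectors a a
  AdjacentVectors-irr a (a≢a , _) = a≢a refl

  closenessGraph : Graph
  closenessGraph = relationGraph adjacentVectors? AdjacentVectors-sym AdjacentVectors-irr

  Edge⇒AdjacentVectors : ∀ {a b} → Edge closenessGraph a b → AdjacentVectors a b
  Edge⇒AdjacentVectors = Edge⇒rel adjacentVectors? AdjacentVectors-sym AdjacentVectors-irr

  AdjacentVectors⇒Edge : ∀ {a b} → AdjacentVectors a b → Edge closenessGraph a b
  AdjacentVectors⇒Edge = rel⇒Edge adjacentVectors? AdjacentVectors-sym AdjacentVectors-irr

  Walk⇒≲ : ∀ {a b m} → Walk closenessGraph a b m → Pointwise (_≲[ m ]_) (L a) (L b)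
  Walk⇒≲ nil = Pointwise-refl (≲-refl _)
  Walk⇒≲ (cons e w) = transitive (≲-trans ∘ proj₁) (proj₂ (Edge⇒AdjacentVectors e)) (Walk⇒≲ w)

module _ (G : Graph) {m : ℕ} (ord : Fin m → V G) (ord-surj : ∀ v → ∃ λ i → ord i ≡ v)
         (dv : V G → Vec ℕ∞ m) (dv-dist : ∀ v i → IsDist G v (ord i) (lookupᵥ (dv v) i))
         {N : ℕ} (L : Fin N → List ℕ∞) (f : V G → Fin N) (L∘f : ∀ v → L (f v) ≡ toList (dv v))
         where

  private
    H : Graph
    H = closenessGraph L

  dv-self : ∀ i → lookupᵥ (dv (ord i)) i ≡ fin 0
  dv-self i = IsDist-unique G _ _ (dv-dist (ord i) i) (IsDist-refl G (ord i))

  f-injective : Injective _≡_ _≡_ f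
  f-injective {u} {v} fu≡fv with ord-surj u
  ... | i , refl = sym (IsDist-zero G (subst (IsDist G v (ord i)) dv-v-i (dv-dist v i)))
    where
    same-vectors : Pointwise _≡_ (toList (dv (ord i))) (toList (dv v))
    same-vectors = ≡⇒Pointwise-≡ (trans (sym (L∘f (ord i))) (trans (cong L fu≡fv) (L∘f v)))

    dv-v-i : lookupᵥ (dv v) i ≡ fin 0
    dv-v-i = trans (sym (Pointwise-toList⁻ same-vectors i)) (dv-self i)

  f-edge : ∀ u v → Edge G u v → Edge H (f u) (f v)
  f-edge u v e = AdjacentVectors⇒Edge L (fu≢fv , close)
    where
    fu≢fv : f u ≢ f v
    fu≢fv fu≡fv = Edge-irrefl G (subst (Edge G u) (sym (f-injective fu≡fv)) e)

    close : Pointwise Close (L (f u)) (L (f v))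
    close rewrite L∘f u | L∘f v = Pointwise-toList⁺ λ i → IsDist-close G e (dv-dist u i) (dv-dist v i)

  Walk-length-bound : ∀ u i {m} → Walk H (f u) (f (ord i)) m → lookupᵥ (dv u) i ≲[ m ] fin 0
  Walk-length-bound u i w
    with Pointwise-toList⁻ (subst₂ (Pointwise _) (L∘f u) (L∘f (ord i)) (Walk⇒≲ L w)) i
  ... | bound rewrite dv-self i = bound

  IsDist-image : ∀ u i d → IsDist G u (ord i) d → IsDist H (f u) (f (ord i)) d
  IsDist-image u i d dG with IsDist-unique G _ d (dv-dist u i) dG
  IsDist-image u i (fin a) (w , _) | dv≡a =
    Walk-map f f-edge w , λ m wH → ≲-fin-zero (subst (_≲[ m ] fin 0) dv≡a (Walk-length-bound u i wH))
  IsDist-image u i ∞ _ | dv≡∞ =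
    λ m wH → ∞-≴-fin (subst (_≲[ m ] fin 0) dv≡∞ (Walk-length-bound u i wH))

  distanceVectorEmbedding : IsometricCopy G H
  distanceVectorEmbedding = isometricCopy f f-edge f-injective dist
    where
    dist : ∀ u v → ∃ λ d → IsDist G u v d × IsDist H (f u) (f v) d
    dist u v with ord-surj v
    ... | i , refl = _ , dv-dist u i , IsDist-image u i _ (dv-dist u i)

bitStrings : ℕ → List (List Bool)
bitStrings zero = [ [] ]
bitStrings (suc k) = [] ∷ map (true ∷_) (bitStrings k) ++ map (false ∷_) (bitStrings k)

suc-length-bitStrings : ∀ k → suc (length (bitStrings k)) ≡ 2 ^ suc k
suc-length-bitStrings zero = refl
suc-length-bitStrings (suc k) = begin
  suc (suc (length (map (true ∷_) B ++ map (false ∷_) B)))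
    ≡⟨ cong (suc ∘ suc) (trans (length-++ (map (true ∷_) B))
                              (cong₂ _+_ (length-map _ B) (length-map _ B))) ⟩
  suc (suc (length B + length B))
    ≡⟨ cong suc (sym (+-suc (length B) (length B))) ⟩
  suc (length B) + suc (length B)
    ≡⟨ cong (λ s → s + s) (suc-length-bitStrings k) ⟩
  2 ^ suc k + 2 ^ suc k
    ≡⟨ cong (2 ^ suc k +_) (sym (+-identityʳ (2 ^ suc k))) ⟩
  2 ^ suc (suc k) ∎
  where
  open ≡-Reasoning
  B : List (List Bool)
  B = bitStrings k

length-bitStrings : ∀ k → length (bitStrings k) ≡ 2 ^ (k + 1) ∸ 1
length-bitStrings k = cong (_∸ 1) (trans (suc-length-bitStrings k) (cong (2 ^_) (+-comm 1 k)))

∈-bitStrings : ∀ {k} (l : List Bool) → length l ≤ k → l ∈ bitStrings k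
∈-bitStrings {zero} [] _ = here refl
∈-bitStrings {suc k} [] _ = here refl
∈-bitStrings {suc k} (true ∷ l) (s≤s l≤k) =
  there (∈-++⁺ˡ (∈-map⁺ (true ∷_) (∈-bitStrings l l≤k)))
∈-bitStrings {suc k} (false ∷ l) (s≤s l≤k) =
  there (∈-++⁺ʳ (map (true ∷_) (bitStrings k)) (∈-map⁺ (false ∷_) (∈-bitStrings l l≤k)))

lemma2p2 : (C : Graph → Set) (k : ℕ) →
    Σ (List Bool → List ℕ∞) (DistanceVectorScheme C k) →
    Σ Graph (λ H → (n H ≤ 2 ^ (k + 1) ∸ 1) × IsometricUniversal C H)
lemma2p2 C k (D , scheme) = closenessGraph L , ≤-reflexive (length-bitStrings k) , universal
  where
  L : Fin (length (bitStrings k)) → List ℕ∞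
  L = D ∘ lookup (bitStrings k)

  universal : IsometricUniversal C (closenessGraph L)
  universal G CG with scheme G CG
  ... | ord , ℓ , ℓ-short , decode =
    distanceVectorEmbedding G (Bijection.to ord) (Bijection.strictlySurjective ord)
      (proj₁ ∘ decode) (proj₂ ∘ proj₂ ∘ decode) L (index ∘ ℓ∈bitStrings) L∘f
    where
    ℓ∈bitStrings : ∀ v → ℓ v ∈ bitStrings k
    ℓ∈bitStrings v = ∈-bitStrings (ℓ v) (ℓ-short v)

    L∘f : ∀ v → L (index (ℓ∈bitStrings v)) ≡ toList (proj₁ (decode v))
    L∘f v = trans (cong D (sym (lookup-index (ℓ∈bitStrings v)))) (proj₁ (proj₂ (decode v)))
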